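{- For every integer $t\ge 2$, every $2$-coloring of the edges of the complete graph on $2^{2t-3}$ vertices contains at least $\frac{1}{t!}2^{\binom{t}{2}-2}$ monochromatic complete subgraphs of size $t$.
   Context: A $2$-coloring of the edges of a complete graph assigns to each edge one of two colors, red or blue. A monochromatic complete subgraph of size $t$ is a set of $t$ vertices all of whose pairs are joined by edges of the same color; such subgraphs are counted as vertex sets. -}

module Defs where

open import Data.Nat using (ℕ)
open import Data.Bool using (Bool; true; false)
open import Data.Fin using (Fin)
open import Data.Fin.Subset using (Subset; _∈_; ∣_∣)
open import Data.Product using (_×_)
open import Relation.Nullary using (¬_)
open import Relation.Binary.PropositionalEquality using (_≡_)

-- A 2-coloring of the edges of the complete graph K_n on vertex set Fin n:
-- each unordered pair {i,j}, i ≠ j, gets a color in Bool (true = red, false = blue).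
-- We represent it as a symmetric function; its values on the diagonal are irrelevant.
record TwoColoring (n : ℕ) : Set where
  field
    color : Fin n → Fin n → Bool
    symmetric : ∀ i j → color i j ≡ color j i
open TwoColoring public

MonoOf : ∀ {n} → TwoColoring n → Bool → Subset n → Set
MonoOf c b S = ∀ i j → i ∈ S → j ∈ S → ¬ (i ≡ j) → color c i j ≡ b

Monochromatic : ∀ {n} → TwoColoring n → Subset n → Set
Monochromatic c S = (MonoOf c true S) Data.Sum.⊎ (MonoOf c false S)
  where import Data.Sum

MonoKt : ∀ {n} → TwoColoring n → ℕ → Subset n → Set
MonoKt c t S = (∣ S ∣ ≡ t) × Monochromatic c S

-- Cliques are counted as ordered vertex lists, along the Erdős–Szekeres recursion.
-- If |S| ≥ 2^m and a + b ≤ m + 1, and X, Y count the ordered red K_{a+1}'s and blue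
-- K_{b+1}'s in S, then 2^(1+2+⋯+m) ≤ w(a,b,m) X + w(b,a,m) Y. Splitting the lists by
-- their first vertex v, one colour class of neighbours of v has 2^(m-1) vertices, so the
-- bound for (a-1, b, m-1) or (a, b-1, m-1) applies inside it; summing over v ∈ S and
-- rescaling from |S| to 2^m gives the recursion defining w. The normalised weight
-- w(a,b,m) 2^(C(a+1,2) - C(m+1,2)) stays below (2 - 2^(a-m))² ≤ 4, so a = b = t - 1 and
-- m = 2t - 3 give 2^(C(t,2) - 2) ordered monochromatic K_t's, and every vertex set of
-- size t occurs at most t! times among them.
module Submission where

open import Defs
open import Data.Nat
open import Data.Nat.Properties
open import Data.Nat.Combinatorics using (_C_; nCk+nC[k+1]≡[n+1]C[k+1]; nC1≡n)
open import Data.Nat.ListAction using (sum)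
open import Data.Nat.Tactic.RingSolver using (solve-∀)
open import Data.Bool as Bool using (Bool; true; false)
open import Data.Empty using (⊥)
open import Data.Fin as Fin using (Fin; zero; suc)
open import Data.Fin.Subset using (Subset; inside; outside; ⁅_⁆; _∪_; ∣_∣)
  renaming (⊥ to ∅; _∈_ to _∈ₛ_; _∉_ to _∉ₛ_)
open import Data.Fin.Subset.Properties
  using (∉⊥; ∣⊥∣≡0; x∈⁅x⁆; x∈⁅y⁆⇒x≡y; x∈p∪q⁺; x∈p∪q⁻; ∪-identityˡ)
open import Data.Vec using (_∷_; here; there)
import Data.Vec.Properties as Vec
open import Data.List using (List; []; _∷_; [_]; length; map; filter; concatMap; foldr; _++_; allFin)
open import Data.List.Properties
  using (≡-dec; length-++; length-map; length-filter; length-tabulate; filter-notAll;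
         ∷-injectiveˡ; ∷-injectiveʳ)
open import Data.List.Membership.Propositional using (_∈_; find; lose)
open import Data.List.Membership.Propositional.Properties
  using (∈-filter⁺; ∈-filter⁻; ∈-map⁺; ∈-map⁻; ∈-++⁺ˡ; ∈-++⁺ʳ; ∈-++⁻;
         ∈-concatMap⁺; ∈-concatMap⁻)
open import Data.List.Relation.Binary.Subset.Propositional using (_⊆_)
import Data.List.Relation.Binary.Subset.Propositional.Properties as ⊆
open import Data.List.Relation.Binary.Disjoint.Propositional using (Disjoint)
open import Data.List.Relation.Unary.Any as Any using (here; there)
open import Data.List.Relation.Unary.All as All using (All; []; _∷_)
import Data.List.Relation.Unary.All.Properties as All
open import Data.List.Relation.Unary.AllPairs as AllPairs using (AllPairs; []; _∷_)
import Data.List.Relation.Unary.AllPairs.Properties as AllPairs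
open import Data.List.Relation.Unary.Unique.Propositional using (Unique)
import Data.List.Relation.Unary.Unique.Propositional.Properties as Unique
open import Data.Product using (Σ; ∃-syntax; _×_; _,_; proj₁; proj₂)
open import Data.Sum using (_⊎_; inj₁; inj₂)
open import Function using (_∘_)
open import Level using (0ℓ)
open import Relation.Binary using (Rel; Decidable; DecidableEquality; Symmetric)
open import Relation.Binary.PropositionalEquality
  using (_≡_; _≢_; refl; sym; trans; cong; cong₂; subst; subst₂; module ≡-Reasoning)
open import Relation.Nullary using (¬_; yes; no; ¬?; _×-dec_; contradiction)
open import Relation.Unary using (Pred) renaming (Decidable to Decidable₁)

2*n≤1+x+y⇒n≤x⊎n≤y : ∀ {n x y} → 2 * n ≤ suc (x + y) → n ≤ x ⊎ n ≤ y
2*n≤1+x+y⇒n≤x⊎n≤y {n} {x} {y} h with n ≤? x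
... | yes n≤x = inj₁ n≤x
... | no  n≰x = inj₂ (+-cancelˡ-≤ n _ _ (begin
  n + n     ≡⟨ cong (n +_) (+-identityʳ n) ⟨
  2 * n     ≤⟨ h ⟩
  suc x + y ≤⟨ +-monoˡ-≤ y (≰⇒> n≰x) ⟩
  n + y     ∎))
  where open ≤-Reasoning

N*d≤a+N*b⇒K*d≤a+K*b : ∀ {N K a b d} → K ≤ N → N * d ≤ a + N * b → K * d ≤ a + K * b
N*d≤a+N*b⇒K*d≤a+K*b {N} {K} {a} {b} {d} K≤N Nd≤a+Nb with ≤-total d b
... | inj₁ d≤b = ≤-trans (*-monoʳ-≤ K d≤b) (m≤n+m (K * b) a)
... | inj₂ b≤d = begin
  K * d         ≡⟨ cong (K *_) (m+[n∸m]≡n b≤d) ⟨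
  K * (b + e)   ≡⟨ *-distribˡ-+ K b e ⟩
  K * b + K * e ≤⟨ +-monoʳ-≤ (K * b) (≤-trans (*-monoˡ-≤ e K≤N) Ne≤a) ⟩
  K * b + a     ≡⟨ +-comm (K * b) a ⟩
  a + K * b     ∎
  where
  open ≤-Reasoning
  e = d ∸ b
  Ne≤a : N * e ≤ a
  Ne≤a = +-cancelˡ-≤ (N * b) _ _ (begin
    N * b + N * e ≡⟨ *-distribˡ-+ N b e ⟨
    N * (b + e)   ≡⟨ cong (N *_) (m+[n∸m]≡n b≤d) ⟩
    N * d         ≤⟨ Nd≤a+Nb ⟩
    a + N * b     ≡⟨ +-comm a (N * b) ⟩
    N * b + a     ∎)

triangle : ℕ → ℕ
triangle zero    = 0
triangle (suc m) = suc m + triangle m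

suc-C-2≡triangle : ∀ m → suc m C 2 ≡ triangle m
suc-C-2≡triangle zero    = refl
suc-C-2≡triangle (suc m) = begin
  suc (suc m) C 2       ≡⟨ nCk+nC[k+1]≡[n+1]C[k+1] (suc m) 1 ⟨
  suc m C 1 + suc m C 2 ≡⟨ cong₂ _+_ (nC1≡n (suc m)) (suc-C-2≡triangle m) ⟩
  suc m + triangle m    ∎
  where open ≡-Reasoning

2^triangle-suc : ∀ m → 2 ^ triangle (suc m) ≡ 2 ^ suc m * 2 ^ triangle m
2^triangle-suc m = ^-distribˡ-+-* 2 (suc m) (triangle m)

2^triangle≡2^m*2^triangle-pred : ∀ m → 2 ^ triangle m ≡ 2 ^ m * 2 ^ triangle (pred m)
2^triangle≡2^m*2^triangle-pred zero    = refl
2^triangle≡2^m*2^triangle-pred (suc m) = 2^triangle-suc m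

weight : ℕ → ℕ → ℕ → ℕ
weight zero    b       m       = 2 ^ triangle (pred m)
weight (suc a) zero    m       = 0
weight (suc a) (suc b) zero    = 0
weight (suc a) (suc b) (suc m) = weight a (suc b) m + 2 ^ suc m * weight (suc a) b m

weight-vanishes : ∀ a b m → m ≤ a → weight (suc a) b m ≡ 0
weight-vanishes a       zero    m       _         = refl
weight-vanishes a       (suc b) zero    _         = refl
weight-vanishes (suc a) (suc b) (suc m) (s≤s m≤a)
  rewrite weight-vanishes a (suc b) m m≤a | weight-vanishes (suc a) b m (m≤n⇒m≤1+n m≤a) =
  *-zeroʳ (2 ^ suc m)

scaled-weight-suc : ∀ a b m →
  2 ^ triangle (suc a) * weight (suc a) (suc b) (suc m) ≡
  2 ^ suc a * (2 ^ triangle a * weight a (suc b) m) + 2 ^ suc m * (2 ^ triangle (suc a) * weight (suc a) b m)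
scaled-weight-suc a b m =
  subst (λ T′ → T′ * (w₁ + N * w₂) ≡ 2 ^ suc a * (2 ^ triangle a * w₁) + N * (T′ * w₂))
        (sym (2^triangle-suc a))
        (distrib (2 ^ suc a) (2 ^ triangle a) w₁ N w₂)
  where
  N = 2 ^ suc m
  w₁ = weight a (suc b) m
  w₂ = weight (suc a) b m
  distrib : ∀ g t x n y → g * t * (x + n * y) ≡ g * (t * x) + n * (g * t * y)
  distrib = solve-∀

-- u ≤ (2 - q/K)² D, with the denominators cleared.
SquareBound : ℕ → ℕ → ℕ → ℕ → Set
SquareBound q K u D = K * K * u + 4 * q * K * D ≤ (4 * K * K + q * q) * D

squareBound-base : ∀ K e → 1 ≤ K → SquareBound 1 K e (K * e)
squareBound-base (suc k) e _ = ≤-trans (m≤m+n _ _) (≤-reflexive (expand k e))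
  where
  -- the slack is K e (4K - 1)(K - 1)
  expand : ∀ k e → let K = suc k in
    K * K * e + 4 * 1 * K * (K * e) + K * e * ((4 * k + 3) * k) ≡ (4 * K * K + 1 * 1) * (K * e)
  expand = solve-∀

squareBound-zero : ∀ K D → 1 ≤ K → SquareBound 1 K 0 D
squareBound-zero (suc k) D _ = ≤-trans (m≤m+n _ _) (≤-reflexive (expand k D))
  where
  expand : ∀ k D → let K = suc k in
    K * K * 0 + 4 * 1 * K * D + (4 * K * k + 1) * D ≡ (4 * K * K + 1 * 1) * D
  expand = solve-∀

squareBound-double : ∀ {K u D} → SquareBound 1 K u D → SquareBound 2 (2 * K) u D
squareBound-double {K} {u} {D} h = begin
  2 * K * (2 * K) * u + 4 * 2 * (2 * K) * D ≡⟨ scale K u D ⟩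
  4 * (K * K * u + 4 * 1 * K * D)         ≤⟨ *-monoʳ-≤ 4 h ⟩
  4 * ((4 * K * K + 1 * 1) * D)           ≡⟨ scale′ K D ⟩
  (4 * (2 * K) * (2 * K) + 2 * 2) * D     ∎
  where
  open ≤-Reasoning
  scale : ∀ K u D → 2 * K * (2 * K) * u + 4 * 2 * (2 * K) * D ≡ 4 * (K * K * u + 4 * 1 * K * D)
  scale = solve-∀
  scale′ : ∀ K D → 4 * ((4 * K * K + 1 * 1) * D) ≡ (4 * (2 * K) * (2 * K) + 2 * 2) * D
  scale′ = solve-∀

-- (2 - 1/K)² / K + (2 - 2/K)² = (2 - 1/K)² - (K - 1)/K³
squareBound-step : ∀ G {K u₁ u₂ D} → 1 ≤ K → SquareBound 1 K u₁ D → SquareBound 2 K u₂ D →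
                   SquareBound 1 K (G * u₁ + G * K * u₂) (G * K * D)
squareBound-step G {K} {u₁} {u₂} {D} 1≤K h₁ h₂ = +-cancelʳ-≤ extra _ _ (begin
  K * K * (G * u₁ + G * K * u₂) + 4 * 1 * K * (G * K * D) + extra
    ≡⟨ regroup G K u₁ u₂ D ⟩
  G * (K * K * u₁ + 4 * 1 * K * D) + G * K * (K * K * u₂ + 4 * 2 * K * D) + 4 * G * K * K * D
    ≤⟨ +-monoˡ-≤ _ (+-mono-≤ (*-monoʳ-≤ G h₁) (*-monoʳ-≤ (G * K) h₂)) ⟩
  G * ((4 * K * K + 1 * 1) * D) + G * K * ((4 * K * K + 2 * 2) * D) + 4 * G * K * K * D
    ≡⟨ regroup′ G K D ⟩
  X + G * (1 * D)
    ≤⟨ +-monoʳ-≤ X (*-monoʳ-≤ G (*-monoˡ-≤ D 1≤K)) ⟩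
  X + G * (K * D)
    ≡⟨ regroup″ G K D ⟩
  (4 * K * K + 1 * 1) * (G * K * D) + extra ∎)
  where
  open ≤-Reasoning
  extra = 4 * G * K * D + 8 * G * K * K * D
  X = 4 * G * K * K * K * D + 4 * G * K * D + 8 * G * K * K * D
  regroup : ∀ G K u₁ u₂ D →
    K * K * (G * u₁ + G * K * u₂) + 4 * 1 * K * (G * K * D) + (4 * G * K * D + 8 * G * K * K * D) ≡
    G * (K * K * u₁ + 4 * 1 * K * D) + G * K * (K * K * u₂ + 4 * 2 * K * D) + 4 * G * K * K * D
  regroup = solve-∀
  regroup′ : ∀ G K D →
    G * ((4 * K * K + 1 * 1) * D) + G * K * ((4 * K * K + 2 * 2) * D) + 4 * G * K * K * D ≡
    (4 * G * K * K * K * D + 4 * G * K * D + 8 * G * K * K * D) + G * (1 * D)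
  regroup′ = solve-∀
  regroup″ : ∀ G K D →
    (4 * G * K * K * K * D + 4 * G * K * D + 8 * G * K * K * D) + G * (K * D) ≡
    (4 * K * K + 1 * 1) * (G * K * D) + (4 * G * K * D + 8 * G * K * K * D)
  regroup″ = solve-∀

squareBound⇒≤4* : ∀ {K u D} → 1 ≤ K → SquareBound 1 K u D → u ≤ 4 * D
squareBound⇒≤4* {suc k} {u} {D} _ h = *-cancelˡ-≤ (K * K) (+-cancelʳ-≤ (4 * 1 * K * D) _ _ (begin
  K * K * u + 4 * 1 * K * D       ≤⟨ h ⟩
  (4 * K * K + 1 * 1) * D         ≡⟨ split K D ⟩
  K * K * (4 * D) + 1 * D         ≤⟨ +-monoʳ-≤ (K * K * (4 * D)) (*-monoˡ-≤ D {1} {4 * 1 * K} (s≤s z≤n)) ⟩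
  K * K * (4 * D) + 4 * 1 * K * D ∎))
  where
  open ≤-Reasoning
  K = suc k
  split : ∀ K D → (4 * K * K + 1 * 1) * D ≡ K * K * (4 * D) + 1 * D
  split = solve-∀

weight-squareBound : ∀ a b j →
  SquareBound 1 (2 ^ j) (2 ^ triangle a * weight a b (a + j)) (2 ^ triangle (a + j))
weight-squareBound zero b j =
  subst₂ (SquareBound 1 (2 ^ j)) (sym (*-identityˡ _)) (sym (2^triangle≡2^m*2^triangle-pred j))
    (squareBound-base (2 ^ j) (2 ^ triangle (pred j)) (m^n>0 2 j))
weight-squareBound (suc a) zero j =
  subst (λ u → SquareBound 1 (2 ^ j) u (2 ^ triangle (suc a + j)))
    (sym (*-zeroʳ (2 ^ triangle (suc a))))
    (squareBound-zero (2 ^ j) _ (m^n>0 2 j))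
weight-squareBound (suc a) (suc b) j =
  subst₂ (SquareBound 1 (2 ^ j))
    (trans (cong (λ N → G * u₁ + N * u₂) (sym 2^[1+a+j])) (sym (scaled-weight-suc a b (a + j))))
    (trans (cong (_* 2 ^ triangle (a + j)) (sym 2^[1+a+j])) (sym (2^triangle-suc (a + j))))
    (squareBound-step G (m^n>0 2 j) (weight-squareBound a (suc b) j) (bound₂ j))
  where
  G = 2 ^ suc a
  T′ = 2 ^ triangle (suc a)
  u₁ = 2 ^ triangle a * weight a (suc b) (a + j)
  u₂ = T′ * weight (suc a) b (a + j)
  2^[1+a+j] : 2 ^ suc (a + j) ≡ G * 2 ^ j
  2^[1+a+j] = ^-distribˡ-+-* 2 (suc a) j
  bound₂ : ∀ j → SquareBound 2 (2 ^ j) (T′ * weight (suc a) b (a + j)) (2 ^ triangle (a + j))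
  bound₂ zero = subst (λ u → SquareBound 2 1 u (2 ^ triangle (a + 0)))
    (sym (trans (cong (T′ *_) (weight-vanishes a b (a + 0) (≤-reflexive (+-identityʳ a)))) (*-zeroʳ T′)))
    ≤-refl
  bound₂ (suc j) = subst (λ m → SquareBound 2 (2 ^ suc j) (T′ * weight (suc a) b m) (2 ^ triangle m))
    (sym (+-suc a j))
    (squareBound-double {2 ^ j} (weight-squareBound (suc a) b j))

scaled-weight-bound : ∀ a b j → 2 ^ triangle a * weight a b (a + j) ≤ 4 * 2 ^ triangle (a + j)
scaled-weight-bound a b j = squareBound⇒≤4* (m^n>0 2 j) (weight-squareBound a b j)

private variable
  A B : Set

length-concatMap : ∀ (f : A → List B) {g : A → ℕ} → (∀ x → length (f x) ≡ g x) →
                   ∀ xs → length (concatMap f xs) ≡ sum (map g xs)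
length-concatMap f eq []       = refl
length-concatMap f eq (x ∷ xs) =
  trans (length-++ (f x)) (cong₂ _+_ (eq x) (length-concatMap f eq xs))

sum-map-≤ : ∀ (f : A → ℕ) {c} xs → (∀ {x} → x ∈ xs → f x ≤ c) → sum (map f xs) ≤ length xs * c
sum-map-≤ f []       _ = z≤n
sum-map-≤ f (x ∷ xs) h = +-mono-≤ (h (here refl)) (sum-map-≤ f xs (h ∘ there))

sum-pointwise : ∀ (f g : A → ℕ) {p q d β} xs → (∀ {x} → x ∈ xs → d ≤ p * f x + q * g x + β) →
                length xs * d ≤ p * sum (map f xs) + q * sum (map g xs) + length xs * β
sum-pointwise f g                 []       _ = z≤n
sum-pointwise f g {p} {q} {d} {β} (x ∷ xs) h = begin
  d + length xs * d
    ≤⟨ +-mono-≤ (h (here refl)) (sum-pointwise f g {p} {q} {d} {β} xs (h ∘ there)) ⟩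
  (p * f x + q * g x + β) + (p * sum (map f xs) + q * sum (map g xs) + length xs * β)
    ≡⟨ regroup p q (f x) (g x) β (sum (map f xs)) (sum (map g xs)) (length xs) ⟩
  p * (f x + sum (map f xs)) + q * (g x + sum (map g xs)) + suc (length xs) * β ∎
  where
  open ≤-Reasoning
  regroup : ∀ p q a b β A B l →
    (p * a + q * b + β) + (p * A + q * B + l * β) ≡ p * (a + A) + q * (b + B) + suc l * β
  regroup = solve-∀

length-filter-split : ∀ {P : Pred A 0ℓ} (P? : Decidable₁ P) xs →
  length xs ≡ length (filter P? xs) + length (filter (¬? ∘ P?) xs)
length-filter-split P? []       = refl
length-filter-split P? (x ∷ xs) with P? x
... | yes _ = cong suc (length-filter-split P? xs)
... | no  _ = trans (cong suc (length-filter-split P? xs)) (sym (+-suc _ _))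

allPairs-lookup : ∀ {R : Rel A 0ℓ} → Symmetric R →
                  ∀ {xs x y} → AllPairs R xs → x ∈ xs → y ∈ xs → x ≢ y → R x y
allPairs-lookup sym (_ ∷ _)  (here refl) (here refl) x≢y = contradiction refl x≢y
allPairs-lookup sym (Rx ∷ _) (here refl) (there y∈) _   = All.lookup Rx y∈
allPairs-lookup sym (Ry ∷ _) (there x∈)  (here refl) _   = sym (All.lookup Ry x∈)
allPairs-lookup sym (_ ∷ Rs) (there x∈)  (there y∈) x≢y = allPairs-lookup sym Rs x∈ y∈ x≢y

module _ (_≟_ : DecidableEquality A) where

  unique-⊆⇒length≤ : ∀ {xs ys : List A} → Unique xs → xs ⊆ ys → length xs ≤ length ys
  unique-⊆⇒length≤ {[]}           _            _       = z≤n
  unique-⊆⇒length≤ {x ∷ xs} {ys} (x∉xs ∷ xs!) x∷xs⊆ys = begin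
    suc (length xs)              ≤⟨ s≤s (unique-⊆⇒length≤ xs! xs⊆ys-x) ⟩
    suc (length (filter x≢? ys)) ≤⟨ filter-notAll x≢? ys x∈ys ⟩
    length ys                    ∎
    where
    open ≤-Reasoning
    x≢? = λ y → ¬? (x ≟ y)
    x∈ys = Any.map (λ x≡y x≢y → x≢y x≡y) (x∷xs⊆ys (here refl))
    xs⊆ys-x : xs ⊆ filter x≢? ys
    xs⊆ys-x y∈xs = ∈-filter⁺ x≢? (x∷xs⊆ys (there y∈xs)) (All.lookup x∉xs y∈xs)

module _ {B : Set} (_≟_ : DecidableEquality B) (f : A → B) (k : ℕ) where

  FibresAtMost : List A → Set
  FibresAtMost Z =
    ∀ {z} → z ∈ Z → ∀ ys → Unique ys → All (λ y → y ∈ Z × f y ≡ f z) ys → length ys ≤ k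

  otherFibres : A → List A → List A
  otherFibres z = filter (λ y → ¬? (f y ≟ f z))

  fibresAtMost-otherFibres : ∀ {z Z} → FibresAtMost (z ∷ Z) → FibresAtMost (otherFibres z Z)
  fibresAtMost-otherFibres {z} {Z} fib w∈ ys ys! ys∈ =
    fib (there (others⊆Z w∈)) ys ys! (All.map (λ (y∈ , eq) → there (others⊆Z y∈) , eq) ys∈)
    where others⊆Z = ⊆.filter-⊆ (λ y → ¬? (f y ≟ f z)) Z

  -- The bound n on length Z only serves as a termination measure.
  distinct-images : ∀ n Z → length Z ≤ n → Unique Z → FibresAtMost Z →
    ∃[ L ] Unique L × L ⊆ map f Z × length Z ≤ k * length L
  distinct-images _       []      _           _          _   = [] , [] , (λ ()) , z≤n
  distinct-images (suc n) (z ∷ Z) (s≤s |Z|≤n) (z∉Z ∷ Z!) fib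
    with distinct-images n (otherFibres z Z) (≤-trans (length-filter other? Z) |Z|≤n)
           (Unique.filter⁺ other? Z!) (fibresAtMost-otherFibres fib)
    where other? = λ y → ¬? (f y ≟ f z)
  ... | L , L! , L⊆ , |others|≤k|L| = f z ∷ L , All.tabulate fz∉L ∷ L! , fz∷L⊆ , bound
    where
    same? = λ y → f y ≟ f z
    same = filter same? Z
    fz∉L : ∀ {T} → T ∈ L → f z ≢ T
    fz∉L T∈L fz≡T with ∈-map⁻ f (L⊆ T∈L)
    ... | y , y∈others , T≡fy =
      proj₂ (∈-filter⁻ (¬? ∘ same?) {xs = Z} y∈others) (trans (sym T≡fy) (sym fz≡T))
    fz∷L⊆ : f z ∷ L ⊆ map f (z ∷ Z)
    fz∷L⊆ (here refl)  = here refl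
    fz∷L⊆ (there T∈L) = there (⊆.map⁺ f (⊆.filter-⊆ (¬? ∘ same?) Z) (L⊆ T∈L))
    z∷same! : Unique (z ∷ same)
    z∷same! = All.filter⁺ same? z∉Z ∷ Unique.filter⁺ same? Z!
    z∷same∈ : All (λ y → y ∈ z ∷ Z × f y ≡ f z) (z ∷ same)
    z∷same∈ = (here refl , refl) ∷
      All.tabulate (λ y∈ → let y∈Z , eq = ∈-filter⁻ same? {xs = Z} y∈ in there y∈Z , eq)
    bound : suc (length Z) ≤ k * suc (length L)
    bound = begin
      suc (length Z)
        ≡⟨ cong suc (length-filter-split same? Z) ⟩
      suc (length same) + length (otherFibres z Z)
        ≤⟨ +-mono-≤ (fib (here refl) (z ∷ same) z∷same! z∷same∈) |others|≤k|L| ⟩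
      k + k * length L
        ≡⟨ *-suc k (length L) ⟨
      k * suc (length L) ∎
      where open ≤-Reasoning

module Cliques {A : Set} (_~_ : Rel A 0ℓ) (_~?_ : Decidable _~_) where

  neighbours : A → List A → List A
  neighbours v = filter (v ~?_)

  cliques : ℕ → List A → List (List A)
  cliquesFrom : ℕ → List A → A → List (List A)
  cliques zero    S = [ [] ]
  cliques (suc k) S = concatMap (cliquesFrom k S) S
  cliquesFrom k S v = map (v ∷_) (cliques k (neighbours v S))

  ∈-cliques⁻ : ∀ k S {z} → z ∈ cliques k S → length z ≡ k × z ⊆ S × AllPairs _~_ z
  ∈-cliques⁻ zero    S (here refl) = refl , (λ ()) , []
  ∈-cliques⁻ (suc k) S z∈ with find (∈-concatMap⁻ (cliquesFrom k S) {xs = S} z∈)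
  ... | v , v∈S , z∈from with ∈-map⁻ (v ∷_) z∈from
  ...   | z′ , z′∈ , refl with ∈-cliques⁻ k (neighbours v S) z′∈
  ...     | len , z′⊆ , pairs =
    cong suc len ,
    ⊆.∈-∷⁺ʳ v∈S (⊆.⊆-trans z′⊆ (⊆.filter-⊆ (v ~?_) S)) ,
    All.tabulate (λ y∈ → proj₂ (∈-filter⁻ (v ~?_) {xs = S} (z′⊆ y∈))) ∷ pairs

  ∈-cliques⁺ : ∀ k S {z} → length z ≡ k → z ⊆ S → AllPairs _~_ z → z ∈ cliques k S
  ∈-cliques⁺ zero    S {[]}     _   _   _               = here refl
  ∈-cliques⁺ (suc k) S {v ∷ z′} len z⊆S (v~z′ ∷ pairs) =
    ∈-concatMap⁺ (cliquesFrom k S) (lose (z⊆S (here refl)) (∈-map⁺ (v ∷_) z′∈))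
    where
    z′∈ = ∈-cliques⁺ k (neighbours v S) (suc-injective len)
            (λ y∈ → ∈-filter⁺ (v ~?_) (z⊆S (there y∈)) (All.lookup v~z′ y∈)) pairs

  cliques-unique : ∀ k {S} → Unique S → Unique (cliques k S)
  cliques-unique zero    _      = [] ∷ []
  cliques-unique (suc k) {S} S! = Unique.concat⁺
    (All.map⁺ (All.tabulate λ {v} _ →
      Unique.map⁺ ∷-injectiveʳ (cliques-unique k (Unique.filter⁺ (v ~?_) S!))))
    (AllPairs.map⁺ (AllPairs.map disjoint S!))
    where
    disjoint : ∀ {v w} → v ≢ w → Disjoint (cliquesFrom k S v) (cliquesFrom k S w)
    disjoint v≢w (p , q) with ∈-map⁻ _ p | ∈-map⁻ _ q
    ... | _ , _ , refl | _ , _ , eq = v≢w (∷-injectiveˡ eq)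

  length-cliques-suc : ∀ k S →
    length (cliques (suc k) S) ≡ sum (map (λ v → length (cliques k (neighbours v S))) S)
  length-cliques-suc k S =
    length-concatMap (cliquesFrom k S) (λ v → length-map (v ∷_) (cliques k (neighbours v S))) S

  length-cliques-1 : ∀ S → length (cliques 1 S) ≡ length S
  length-cliques-1 S = trans (length-cliques-suc 0 S) (sum-ones S)
    where
    sum-ones : ∀ xs → sum (map (λ _ → 1) xs) ≡ length xs
    sum-ones []       = refl
    sum-ones (_ ∷ xs) = cong suc (sum-ones xs)

  length-cliques≤! : (∀ {v} → ¬ v ~ v) → ∀ k S → length S ≤ k → length (cliques k S) ≤ k !
  length-cliques≤! irrefl zero    S _       = ≤-refl
  length-cliques≤! irrefl (suc k) S |S|≤1+k = begin
    length (cliques (suc k) S)                              ≡⟨ length-cliques-suc k S ⟩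
    sum (map (λ v → length (cliques k (neighbours v S))) S) ≤⟨ sum-map-≤ _ S shrinks ⟩
    length S * k !                                          ≤⟨ *-monoˡ-≤ (k !) |S|≤1+k ⟩
    suc k !                                                 ∎
    where
    open ≤-Reasoning
    shrinks : ∀ {v} → v ∈ S → length (cliques k (neighbours v S)) ≤ k !
    shrinks {v} v∈S = length-cliques≤! irrefl k (neighbours v S)
      (≤-pred (≤-trans (filter-notAll (v ~?_) S (lose v∈S irrefl)) |S|≤1+k))

  length-cliques-mono : DecidableEquality A → ∀ k {R S} → Unique R → R ⊆ S →
                        length (cliques k R) ≤ length (cliques k S)
  length-cliques-mono _≟_ k {R} {S} R! R⊆S =
    unique-⊆⇒length≤ (≡-dec _≟_) (cliques-unique k R!) λ z∈ →
      let len , z⊆R , pairs = ∈-cliques⁻ k R z∈ in ∈-cliques⁺ k S len (⊆.⊆-trans z⊆R R⊆S) pairs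

fromList : ∀ {n} → List (Fin n) → Subset n
fromList = foldr (λ x p → ⁅ x ⁆ ∪ p) ∅

∈-fromList⁺ : ∀ {n} {i : Fin n} {xs} → i ∈ xs → i ∈ₛ fromList xs
∈-fromList⁺ {i = i} (here refl) = x∈p∪q⁺ (inj₁ (x∈⁅x⁆ i))
∈-fromList⁺ (there i∈xs)        = x∈p∪q⁺ (inj₂ (∈-fromList⁺ i∈xs))

∈-fromList⁻ : ∀ {n} {i : Fin n} xs → i ∈ₛ fromList xs → i ∈ xs
∈-fromList⁻ []       i∈ = contradiction i∈ ∉⊥
∈-fromList⁻ (x ∷ xs) i∈ with x∈p∪q⁻ ⁅ x ⁆ (fromList xs) i∈
... | inj₁ i∈⁅x⁆ = here (x∈⁅y⁆⇒x≡y x i∈⁅x⁆)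
... | inj₂ i∈p   = there (∈-fromList⁻ xs i∈p)

∣⁅x⁆∪p∣≡1+∣p∣ : ∀ {n} (x : Fin n) p → x ∉ₛ p → ∣ ⁅ x ⁆ ∪ p ∣ ≡ suc ∣ p ∣
∣⁅x⁆∪p∣≡1+∣p∣ zero    (outside ∷ p) _   = cong (λ q → suc ∣ q ∣) (∪-identityˡ p)
∣⁅x⁆∪p∣≡1+∣p∣ zero    (inside  ∷ p) x∉p = contradiction here x∉p
∣⁅x⁆∪p∣≡1+∣p∣ (suc x) (outside ∷ p) x∉p = ∣⁅x⁆∪p∣≡1+∣p∣ x p (x∉p ∘ there)
∣⁅x⁆∪p∣≡1+∣p∣ (suc x) (inside  ∷ p) x∉p =
  cong suc (∣⁅x⁆∪p∣≡1+∣p∣ x p (x∉p ∘ there))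

∣fromList∣≡length : ∀ {n} {xs : List (Fin n)} → Unique xs → ∣ fromList xs ∣ ≡ length xs
∣fromList∣≡length {n} {[]}      _            = ∣⊥∣≡0 n
∣fromList∣≡length {xs = x ∷ xs} (x∉xs ∷ xs!) =
  trans (∣⁅x⁆∪p∣≡1+∣p∣ x (fromList xs) (λ x∈ → All.lookup x∉xs (∈-fromList⁻ xs x∈) refl))
        (cong suc (∣fromList∣≡length xs!))

module _ {n : ℕ} (c : TwoColoring n) where

  Adjacent : Bool → Rel (Fin n) 0ℓ
  Adjacent b v w = v ≢ w × color c v w ≡ b

  adjacent? : ∀ b → Decidable (Adjacent b)
  adjacent? b v w = ¬? (v Fin.≟ w) ×-dec (color c v w Bool.≟ b)

  adjacent-sym : ∀ {b} → Symmetric (Adjacent b)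
  adjacent-sym {_} {v} {w} (v≢w , col) = v≢w ∘ sym , trans (symmetric c w v) col

  module Mono (b : Bool) = Cliques (Adjacent b) (adjacent? b)
  open Mono using (cliques; neighbours)

  #cliques : Bool → ℕ → List (Fin n) → ℕ
  #cliques b k S = length (cliques b k S)

  #cliques-neighbours≤ : ∀ b′ k v b {S} → Unique S →
                         #cliques b′ k (neighbours b v S) ≤ #cliques b′ k S
  #cliques-neighbours≤ b′ k v b {S} S! = Mono.length-cliques-mono b′ Fin._≟_ k
    (Unique.filter⁺ (adjacent? b v) S!) (⊆.filter-⊆ (adjacent? b v) S)

  length≤1+#neighbours : ∀ v {S} → Unique S →
    length S ≤ suc (length (neighbours true v S) + length (neighbours false v S))
  length≤1+#neighbours v {S} S! = begin
    length S
      ≤⟨ unique-⊆⇒length≤ Fin._≟_ S! S⊆ ⟩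
    suc (length (neighbours true v S ++ neighbours false v S))
      ≡⟨ cong suc (length-++ (neighbours true v S)) ⟩
    suc (length (neighbours true v S) + length (neighbours false v S)) ∎
    where
    open ≤-Reasoning
    S⊆ : S ⊆ v ∷ neighbours true v S ++ neighbours false v S
    S⊆ {w} w∈S with v Fin.≟ w | color c v w in col
    ... | yes refl | _     = here refl
    ... | no v≢w   | true  = there (∈-++⁺ˡ (∈-filter⁺ (adjacent? true v) w∈S (v≢w , col)))
    ... | no v≢w   | false = there (∈-++⁺ʳ _ (∈-filter⁺ (adjacent? false v) w∈S (v≢w , col)))

  WeightedBound : ℕ → ℕ → ℕ → Set
  WeightedBound a b m = ∀ {S} → Unique S → 2 ^ m ≤ length S →
    2 ^ triangle m ≤ weight a b m * #cliques true (suc a) S + weight b a m * #cliques false (suc b) S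

  2^triangle≤#cliques-1 : ∀ b m S → 2 ^ m ≤ length S →
                          2 ^ triangle m ≤ 2 ^ triangle (pred m) * #cliques b 1 S
  2^triangle≤#cliques-1 b m S |S|≥2^m = begin
    2 ^ triangle m     ≡⟨ 2^triangle≡2^m*2^triangle-pred m ⟩
    2 ^ m * E          ≤⟨ *-monoˡ-≤ E |S|≥2^m ⟩
    length S * E       ≡⟨ *-comm (length S) E ⟩
    E * length S       ≡⟨ cong (E *_) (Mono.length-cliques-1 b S) ⟨
    E * #cliques b 1 S ∎
    where
    open ≤-Reasoning
    E = 2 ^ triangle (pred m)

  weightedBound-step : ∀ a b m → WeightedBound a (suc b) m → WeightedBound (suc a) b m →
                       WeightedBound (suc a) (suc b) (suc m)
  weightedBound-step a b m bound₁ bound₂ {S} S! |S|≥ =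
    subst₂ _≤_ (sym (2^triangle-suc m)) (regroup p₁ p₂ q₁ q₂ (2 ^ suc m) X Y)
      (N*d≤a+N*b⇒K*d≤a+K*b |S|≥
        (subst₂ (λ x y → length S * D ≤ p₁ * x + q₂ * y + length S * (q₁ * Y + p₂ * X))
          (sym (Mono.length-cliques-suc true (suc a) S)) (sym (Mono.length-cliques-suc false (suc b) S))
          (sum-pointwise fX fY {p₁} {q₂} S pointwise)))
    where
    D = 2 ^ triangle m
    p₁ = weight a (suc b) m
    q₁ = weight (suc b) a m
    p₂ = weight (suc a) b m
    q₂ = weight b (suc a) m
    X = #cliques true (suc (suc a)) S
    Y = #cliques false (suc (suc b)) S
    fX = λ v → #cliques true (suc a) (neighbours true v S)
    fY = λ v → #cliques false (suc b) (neighbours false v S)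
    pointwise : ∀ {v} → v ∈ S → D ≤ p₁ * fX v + q₂ * fY v + (q₁ * Y + p₂ * X)
    pointwise {v} _ with 2*n≤1+x+y⇒n≤x⊎n≤y (≤-trans |S|≥ (length≤1+#neighbours v S!))
    ... | inj₁ many-red = begin
      D
        ≤⟨ bound₁ (Unique.filter⁺ (adjacent? true v) S!) many-red ⟩
      p₁ * fX v + q₁ * #cliques false (suc (suc b)) (neighbours true v S)
        ≤⟨ +-monoʳ-≤ (p₁ * fX v) (*-monoʳ-≤ q₁
             (#cliques-neighbours≤ false (suc (suc b)) v true S!)) ⟩
      p₁ * fX v + q₁ * Y
        ≤⟨ +-mono-≤ (m≤m+n (p₁ * fX v) (q₂ * fY v)) (m≤m+n (q₁ * Y) (p₂ * X)) ⟩
      p₁ * fX v + q₂ * fY v + (q₁ * Y + p₂ * X) ∎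
      where open ≤-Reasoning
    ... | inj₂ many-blue = begin
      D
        ≤⟨ bound₂ (Unique.filter⁺ (adjacent? false v) S!) many-blue ⟩
      p₂ * #cliques true (suc (suc a)) (neighbours false v S) + q₂ * fY v
        ≤⟨ +-monoˡ-≤ (q₂ * fY v) (*-monoʳ-≤ p₂
             (#cliques-neighbours≤ true (suc (suc a)) v false S!)) ⟩
      p₂ * X + q₂ * fY v
        ≡⟨ +-comm (p₂ * X) (q₂ * fY v) ⟩
      q₂ * fY v + p₂ * X
        ≤⟨ +-mono-≤ (m≤n+m (q₂ * fY v) (p₁ * fX v)) (m≤n+m (p₂ * X) (q₁ * Y)) ⟩
      p₁ * fX v + q₂ * fY v + (q₁ * Y + p₂ * X) ∎
      where open ≤-Reasoning
    regroup : ∀ p₁ p₂ q₁ q₂ K X Y →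
      p₁ * X + q₂ * Y + K * (q₁ * Y + p₂ * X) ≡ (p₁ + K * p₂) * X + (q₂ + K * q₁) * Y
    regroup = solve-∀

  weightedBound : ∀ a b m → a + b ≤ suc m → WeightedBound a b m
  weightedBound zero    b       m       _ {S} _ |S|≥ =
    ≤-trans (2^triangle≤#cliques-1 true m S |S|≥) (m≤m+n _ _)
  weightedBound (suc a) zero    m       _ {S} _ |S|≥ = 2^triangle≤#cliques-1 false m S |S|≥
  weightedBound (suc a) (suc b) zero    (s≤s a+1+b≤0) =
    contradiction (≤-trans (m≤n+m (suc b) a) a+1+b≤0) λ ()
  weightedBound (suc a) (suc b) (suc m) (s≤s a+b≤) = weightedBound-step a b m
    (weightedBound a (suc b) m a+b≤)
    (weightedBound (suc a) b m (≤-trans (≤-reflexive (sym (+-suc a b))) a+b≤))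

  monoCliques : ℕ → List (Fin n) → List (List (Fin n))
  monoCliques k S = cliques true k S ++ cliques false k S

  ∈-monoCliques⁻ : ∀ k S {z} → z ∈ monoCliques k S →
    length z ≡ k × z ⊆ S × ∃[ b ] AllPairs (Adjacent b) z
  ∈-monoCliques⁻ k S z∈ with ∈-++⁻ (cliques true k S) z∈
  ... | inj₁ z∈red  = let len , z⊆S , pairs = Mono.∈-cliques⁻ true k S z∈red
                      in  len , z⊆S , true , pairs
  ... | inj₂ z∈blue = let len , z⊆S , pairs = Mono.∈-cliques⁻ false k S z∈blue
                      in  len , z⊆S , false , pairs

  monoCliques-unique : ∀ k {S} → 2 ≤ k → Unique S → Unique (monoCliques k S)
  monoCliques-unique k {S} 2≤k S! =
    Unique.++⁺ (Mono.cliques-unique true k S!) (Mono.cliques-unique false k S!) λ (z∈red , z∈blue) →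
      let len , _ , red  = Mono.∈-cliques⁻ true k S z∈red
          _   , _ , blue = Mono.∈-cliques⁻ false k S z∈blue
      in notBoth (≤-trans 2≤k (≤-reflexive (sym len))) red blue
    where
    notBoth : ∀ {z} → 2 ≤ length z → AllPairs (Adjacent true) z → AllPairs (Adjacent false) z → ⊥
    notBoth {_ ∷ []}    (s≤s ())
    notBoth {_ ∷ _ ∷ _} _ (((_ , red) ∷ _) ∷ _) (((_ , blue) ∷ _) ∷ _) =
      contradiction (trans (sym red) blue) λ ()

  2^triangle≤4*#monoCliques : ∀ s {S} → Unique S → 2 ^ suc (s + s) ≤ length S →
    2 ^ triangle (suc s) ≤ 4 * length (monoCliques (suc (suc s)) S)
  2^triangle≤4*#monoCliques s {S} S! |S|≥ = *-cancelˡ-≤ D {{m^n≢0 2 (triangle m)}} (begin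
    D * T              ≡⟨ *-comm D T ⟩
    T * D              ≤⟨ *-monoʳ-≤ T D≤w*|Z| ⟩
    T * (w * length Z) ≡⟨ *-assoc T w (length Z) ⟨
    T * w * length Z   ≤⟨ *-monoˡ-≤ (length Z) (scaled-weight-bound (suc s) (suc s) s) ⟩
    4 * D * length Z   ≡⟨ reorder 4 D (length Z) ⟩
    D * (4 * length Z) ∎)
    where
    open ≤-Reasoning
    m = suc (s + s)
    D = 2 ^ triangle m
    T = 2 ^ triangle (suc s)
    w = weight (suc s) (suc s) m
    Z = monoCliques (suc (suc s)) S
    D≤w*|Z| : D ≤ w * length Z
    D≤w*|Z| = subst (D ≤_)
      (trans (sym (*-distribˡ-+ w _ _)) (cong (w *_) (sym (length-++ (cliques true (suc (suc s)) S)))))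
      (weightedBound (suc s) (suc s) m (≤-reflexive (cong suc (+-suc s s))) S! |S|≥)
    reorder : ∀ a b c → a * b * c ≡ b * (a * c)
    reorder = solve-∀

  monoKt-fromList : ∀ {k S z} → z ∈ monoCliques k S → MonoKt c k (fromList z)
  monoKt-fromList {k} {S} {z} z∈ with ∈-monoCliques⁻ k S z∈
  ... | len , _ , b , pairs = trans (∣fromList∣≡length (AllPairs.map proj₁ pairs)) len , monochromatic b mono
    where
    mono : MonoOf c b (fromList z)
    mono i j i∈ j∈ i≢j =
      proj₂ (allPairs-lookup adjacent-sym pairs (∈-fromList⁻ z i∈) (∈-fromList⁻ z j∈) i≢j)
    monochromatic : ∀ b → MonoOf c b (fromList z) → Monochromatic c (fromList z)
    monochromatic true  = inj₁
    monochromatic false = inj₂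

  module Arrangements = Cliques {Fin n} _≢_ (λ v w → ¬? (v Fin.≟ w))

  fromList-fibres : ∀ k S → FibresAtMost (Vec.≡-dec Bool._≟_) fromList (k !) (monoCliques k S)
  fromList-fibres k S {z} z∈ ys ys! ys∈ = begin
    length ys                         ≤⟨ unique-⊆⇒length≤ (≡-dec Fin._≟_) ys! ys⊆ ⟩
    length (Arrangements.cliques k z) ≤⟨ Arrangements.length-cliques≤! (λ v≢v → v≢v refl) k z
                                                                        (≤-reflexive |z|≡k) ⟩
    k !                               ∎
    where
    open ≤-Reasoning
    |z|≡k = proj₁ (∈-monoCliques⁻ k S z∈)
    ys⊆ : ys ⊆ Arrangements.cliques k z
    ys⊆ y∈ys with All.lookup ys∈ y∈ys
    ... | y∈Z , same with ∈-monoCliques⁻ k S y∈Z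
    ...   | len , _ , _ , pairs = Arrangements.∈-cliques⁺ k z len
            (λ {x} x∈y → ∈-fromList⁻ z (subst (x ∈ₛ_) same (∈-fromList⁺ x∈y)))
            (AllPairs.map proj₁ pairs)

  distinctMonoKt : ∀ k {S} → 2 ≤ k → Unique S →
    ∃[ L ] Unique L × All (MonoKt c k) L × length (monoCliques k S) ≤ k ! * length L
  distinctMonoKt k {S} 2≤k S!
    with distinct-images (Vec.≡-dec Bool._≟_) fromList (k !) _ (monoCliques k S) ≤-refl
           (monoCliques-unique k 2≤k S!) (fromList-fibres k S)
  ... | L , L! , L⊆ , bound = L , L! , All.tabulate monoKt , bound
    where
    monoKt : ∀ {T} → T ∈ L → MonoKt c k T
    monoKt T∈L with ∈-map⁻ fromList (L⊆ T∈L)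
    ... | _ , z∈ , refl = monoKt-fromList z∈

mainTheorem4 : (t : ℕ) → 2 ≤ t → (c : TwoColoring (2 ^ (2 * t ∸ 3))) →
    Σ (List (Subset (2 ^ (2 * t ∸ 3)))) (λ L →
      Unique L × All (MonoKt c t) L × (2 ^ (t C 2) ≤ 4 * ((t !) * length L)))
mainTheorem4 t@(suc (suc s)) 2≤t@(s≤s (s≤s z≤n)) c with distinctMonoKt c t 2≤t (Unique.allFin⁺ _)
... | L , L! , monoKts , |Z|≤t!|L| = L , L! , monoKts , (begin
  2 ^ (t C 2)                             ≡⟨ cong (2 ^_) (suc-C-2≡triangle (suc s)) ⟩
  2 ^ triangle (suc s)                    ≤⟨ 2^triangle≤4*#monoCliques c s (Unique.allFin⁺ n) |allFin|≥ ⟩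
  4 * length (monoCliques c t (allFin n)) ≤⟨ *-monoʳ-≤ 4 |Z|≤t!|L| ⟩
  4 * (t ! * length L)                    ∎)
  where
  open ≤-Reasoning
  n = 2 ^ (2 * t ∸ 3)
  2t∸3≡1+2s : 2 * t ∸ 3 ≡ suc (s + s)
  2t∸3≡1+2s = cong (_∸ 3) (double s)
    where
    double : ∀ s → 2 * suc (suc s) ≡ 3 + suc (s + s)
    double = solve-∀
  |allFin|≥ : 2 ^ suc (s + s) ≤ length (allFin n)
  |allFin|≥ = ≤-reflexive (trans (cong (2 ^_) (sym 2t∸3≡1+2s)) (sym (length-tabulate (λ i → i))))
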